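{- Let $G$ be a p-game and $g$ a p-strategy on $G$. Then there exists a valid t-skeleton $\sigma$ on $G$ (i.e. $\sigma\in\mathcal{TS}(G)$ with $\sigma\lesssim_G\sigma$) such that $\sigma$ implements $g$.
   Context: Moves are triples $(m,x,y)$, $x\in\{O,P\}$, $y\in\{Q,A\}$. A j-sequence is a finite sequence $s$ of moves with pointers $\mathcal J_s(i)<i$ ($0$ = initial); equality means same moves and pointers; $X^{\mathrm{Even}},X^{\mathrm{Odd}}$ denote even/odd-length elements. P-view $\lceil s\rceil$ and O-view $\lfloor s\rfloor$: $\lceil\epsilon\rceil=\epsilon$, $\lceil sm\rceil=\lceil s\rceil m$ ($m$ P-move), $\lceil sm\rceil=m$ ($m$ initial), $\lceil smtn\rceil=\lceil s\rceil mn$ ($n$ O-move justified by $m$); $\lfloor\epsilon\rfloor=\epsilon$, $\lfloor sm\rfloor=\lfloor s\rfloor m$ ($m$ O-move), $\lfloor smtn\rfloor=\lfloor s\rfloor mn$ ($n$ P-move justified by $m$). A legal position is a j-sequence with alternating O/P labels in which the justifier of each non-initial P-move (O-move) lies in the P-view (O-view) of the preceding prefix. A game is a pair $(P,\simeq)$ of a non-empty prefix-closed set of legal positions and an equivalence relation with (I1) $s\simeq t\Rightarrow|s|=|t|$, (I2) $sm\simeq tn\Rightarrow s\simeq t$ with $m,n$ of the same labels and equal pointers, (I3) $s\simeq t\wedge sm\in P\Rightarrow\exists tn\in P.\ sm\simeq tn$, whose induced arena (moves occurring, $\star\vdash m$ iff $m$ occurs initially, $m\vdash n$ iff $n$ occurs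 justified by $m$) has O-question initial moves, answers enabled only by questions, non-$\star$ enabling flipping O/P, and no infinite chain $\star\vdash m_0\vdash m_1\vdash\cdots$. Fix a countable set $\mathcal B\supseteq\{q,tt,ff\}\cup\mathbb N$. A standard move is a move $((m,\mathbf d,\mathbf e),x,y)$ with $m\in\mathcal B$, $\mathbf d\in\{0,1\}^*$, $\mathbf e\in(\mathbb N\times\{0,1\}^*)^*$; $\mathscr J(\mathscr M)$ is the set of j-sequences of standard moves. $s\simeq_{\mathscr U}t$ iff $s,t$ have the same length, labels, pointers and $(m,\mathbf d)$ components at each position, and there are permutations $\varphi_{\mathbf j}$ of $\mathbb N$, indexed by the binary words $\mathbf j$ occurring in the $\mathbf e$-components of $s$, such that each $\mathbf e$-component of $t(l)$ is obtained from that of $s(l)$ by replacing each $(i,\mathbf j)$ with $(\varphi_{\mathbf j}(i),\mathbf j)$. A game $(P,\simeq)$ is standard if its moves are standard, $\simeq\ =\ \simeq_{\mathscr U}\cap(P\times P)$, and $s\in\mathscr J(\mathscr M)$, $t\in P$, $s\simeq_{\mathscr U}t$ imply $s\in P$. A t-skeleton is a non-empty prefix-closed set $S$ of legal positions with $smn,smn'\in S^{\mathrm{Even}}\Rightarrow smn=smn'$ and well-founded induced arena $(M_S,\vdash_S)$; it is standard if $S\subseteq\mathscr J(\mathscr M)$ and $sm\in S$, $sm'\in\mathscr J(\mathscr M)^{\mathrm{Odd}}$, $sm\simeq_{\mathscr U}sm'$ imply $sm'\in S$. A non-empty set $\mathcal S$ of t-skeletons is consistent if $(\bigcup M_\sigma,\bigcup\vdash_\sigma)$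 is well-founded and for $\sigma,\tau\in\mathcal S$, $sm\in(\sigma\cup\tau)^{\mathrm{Odd}}$, $s\in\sigma\cap\tau$ imply $sm\in\sigma\cap\tau$; $\sigma\asymp\tau$ means $\{\sigma,\tau\}$ is consistent. A p-game is a pair $G=(\mathcal{TS}(G),\simeq_G)$ of a non-empty set of standard t-skeletons and an equivalence relation on $P_G=\bigcup\mathcal{TS}(G)$ such that $(P_G,\simeq_G)$ is a standard game and: (det-j completeness) the union of any consistent deterministic ($smn,smn'\in(\bigcup\mathcal S)^{\mathrm{Even}}\Rightarrow smn=smn'$) subset $\mathcal S\subseteq\mathcal{TS}(G)$ lies in $\mathcal{TS}(G)$; (downward) if $\sigma\in\mathcal{TS}(G)$ and a standard t-skeleton $\tilde\sigma\subseteq P_G$ satisfies $\tilde\sigma\asymp\sigma$, $\tilde\sigma\subseteq\sigma$, then $\tilde\sigma\in\mathcal{TS}(G)$; (horizontal) if $\sigma\in\mathcal{TS}(G)$ and a standard t-skeleton $\tilde\sigma\subseteq P_G$ satisfies $\sigma\lesssim_G\tilde\sigma$ and $\tilde\sigma\lesssim_G\sigma$, then $\tilde\sigma\in\mathcal{TS}(G)$; here $\sigma\lesssim_G\tilde\sigma$ iff $\sigma\asymp\tilde\sigma$ and for all $smn\in\sigma^{\mathrm{Even}}$, $\tilde s\tilde m\in\tilde\sigma$ with $sm\simeq_G\tilde s\tilde m$ there is $\tilde s\tilde m\tilde n\in\tilde\sigma$ with $smn\simeq_G\tilde s\tilde m\tilde n$. A t-skeleton on $G$ is an element of $\mathcal{TS}(G)$.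 $\mathsf{Oinc}(S,T)$ means $S\subseteq T$ and $s\in S\wedge sm\in T^{\mathrm{Odd}}\Rightarrow sm\in S$. For $\sigma\in\mathcal{TS}(G)$ and $g\subseteq P_G$, $\sigma$ implements $g$ ($\sigma\propto g$) iff $\mathsf{Oinc}(\sigma,g)$ and for all $smn\in g$ with $s\in\sigma$ there is $smn'\in\sigma$ with $smn\simeq_G smn'$. A p-strategy on $G$ is a subset $g\subseteq P_G$ that is non-empty and prefix-closed, satisfies $smn,tlr\in g^{\mathrm{Even}}\wedge sm\simeq_G tl\Rightarrow smn\simeq_G tlr$, satisfies $s\in g\wedge t\in P_G\wedge s\simeq_G t\Rightarrow t\in g$, and is implemented by some $\sigma\in\mathcal{TS}(G)$. -}

module Defs where

open import Level using (Level; _⊔_; 0ℓ) renaming (suc to lsuc)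
open import Data.Nat using (ℕ; zero; suc; _≤_; _∸_)
open import Data.Bool using (Bool)
open import Data.Unit using (⊤)
open import Data.Empty using (⊥)
open import Data.List using (List; []; _∷_; _∷ʳ_; _++_; length; map; take)
open import Data.Product using (Σ; ∃; ∃-syntax; _×_; _,_; proj₁; proj₂)
open import Data.Sum using (_⊎_)
open import Data.Maybe using (Maybe; just; nothing)
open import Relation.Nullary using (¬_)
open import Relation.Unary using (Pred; _⊆_)
open import Relation.Binary.PropositionalEquality using (_≡_; _≢_)
open import Function.Bundles using (_↔_; Inverse)
open import Function.Definitions using (Injective)
open import Data.List.Relation.Binary.Pointwise using (Pointwise)

record BaseSet : Set₁ where
  field
    𝓑        : Set
    q tt ff  : 𝓑
    nat      : ℕ → 𝓑
    nat-inj  : Injective _≡_ _≡_ nat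
    q≢tt     : q ≢ tt
    q≢ff     : q ≢ ff
    tt≢ff    : tt ≢ ff
    q≢nat    : ∀ n → q ≢ nat n
    tt≢nat   : ∀ n → tt ≢ nat n
    ff≢nat   : ∀ n → ff ≢ nat n
    -- countability: an injection into ℕ
    code     : 𝓑 → ℕ
    code-inj : Injective _≡_ _≡_ code

data Player : Set where
  O P : Player

data Kind : Set where
  Q A : Kind

nth : ∀ {A : Set} → List A → ℕ → Maybe A
nth []       _       = nothing
nth (x ∷ xs) zero    = just x
nth (x ∷ xs) (suc k) = nth xs k

IsEven : ℕ → Set
IsEven zero          = ⊤
IsEven (suc zero)    = ⊥
IsEven (suc (suc n)) = IsEven n

IsOdd : ℕ → Set
IsOdd zero          = ⊥
IsOdd (suc zero)    = ⊤
IsOdd (suc (suc n)) = IsOdd n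

-- label of the move at (0-based) index k of an alternating sequence
-- (1-based position k+1): O at odd positions, P at even positions
parity : ℕ → Player
parity zero          = O
parity (suc zero)    = P
parity (suc (suc k)) = parity k

NoInfChain : ∀ {a ℓ₁ ℓ₂} {M : Set a} → Pred M ℓ₁ → (M → M → Set ℓ₂) → Set (a ⊔ ℓ₁ ⊔ ℓ₂)
NoInfChain {M = M} I E =
  ¬ (Σ (ℕ → M) λ f → I (f 0) × (∀ k → E (f k) (f (suc k))))

module _ (𝔅 : BaseSet) where
  open BaseSet 𝔅

  StdLabel : Set
  StdLabel = 𝓑 × List Bool × List (ℕ × List Bool)

  Move : Set
  Move = StdLabel × Player × Kind

  player : Move → Player
  player (_ , x , _) = x

  kind : Move → Kind
  kind (_ , _ , y) = y

  -- an occurrence: a move together with its pointer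
  -- (pointers are 1-based positions; 0 = initial)
  Occ : Set
  Occ = Move × ℕ

  -- raw sequences; 𝒥(ℳ) is cut out by IsJSeq
  JSeq : Set
  JSeq = List Occ

  IsJSeq : JSeq → Set
  IsJSeq s = ∀ k x → nth s k ≡ just x → proj₂ x ≤ k

  -- membership of a (1-based) position in the P-view ⌈s⌉
  data InPView : JSeq → ℕ → Set where
    p-P-last : ∀ {s m j} → player m ≡ P → InPView (s ∷ʳ (m , j)) (suc (length s))
    p-P-prev : ∀ {s m j i} → player m ≡ P → InPView s i → InPView (s ∷ʳ (m , j)) i
    p-init   : ∀ {s m} → player m ≡ O → InPView (s ∷ʳ (m , 0)) (suc (length s))
    p-O-last : ∀ {s m j} → player m ≡ O → j ≢ 0 → InPView (s ∷ʳ (m , j)) (suc (length s))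
    p-O-just : ∀ {s m j} → player m ≡ O → j ≢ 0 → InPView (s ∷ʳ (m , j)) j
    p-O-prev : ∀ {s m j i} → player m ≡ O → j ≢ 0 →
               InPView (take (j ∸ 1) s) i → InPView (s ∷ʳ (m , j)) i

  -- membership of a (1-based) position in the O-view ⌊s⌋
  data InOView : JSeq → ℕ → Set where
    o-O-last : ∀ {s m j} → player m ≡ O → InOView (s ∷ʳ (m , j)) (suc (length s))
    o-O-prev : ∀ {s m j i} → player m ≡ O → InOView s i → InOView (s ∷ʳ (m , j)) i
    o-P-last : ∀ {s m j} → player m ≡ P → j ≢ 0 → InOView (s ∷ʳ (m , j)) (suc (length s))
    o-P-just : ∀ {s m j} → player m ≡ P → j ≢ 0 → InOView (s ∷ʳ (m , j)) j
    o-P-prev : ∀ {s m j i} → player m ≡ P → j ≢ 0 →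
               InOView (take (j ∸ 1) s) i → InOView (s ∷ʳ (m , j)) i

  record IsLegal (s : JSeq) : Set where
    field
      jseq : IsJSeq s
      alt  : ∀ k x → nth s k ≡ just x → player (proj₁ x) ≡ parity k
      pvis : ∀ k m j → nth s k ≡ just (m , j) → player m ≡ P → j ≢ 0 →
             InPView (take k s) j
      ovis : ∀ k m j → nth s k ≡ just (m , j) → player m ≡ O → j ≢ 0 →
             InOView (take k s) j

  -- induced arena of a set of j-sequences
  InitIn : ∀ {ℓ} → Pred JSeq ℓ → Move → Set ℓ
  InitIn X m = Σ JSeq λ s → X s × ∃ λ k → nth s k ≡ just (m , 0)

  EnablesIn : ∀ {ℓ} → Pred JSeq ℓ → Move → Move → Set ℓ
  EnablesIn X m n = Σ JSeq λ s → X s ×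
    ∃ λ k → ∃ λ j → nth s k ≡ just (n , suc j) × ∃ λ p → nth s j ≡ just (m , p)

  WFArena : ∀ {ℓ} → Pred JSeq ℓ → Set ℓ
  WFArena X = NoInfChain (InitIn X) (EnablesIn X)

  record IsGame {ℓ ℓ'} (Pos : Pred JSeq ℓ) (_≃_ : JSeq → JSeq → Set ℓ') : Set (ℓ ⊔ ℓ') where
    field
      nonempty : Σ JSeq Pos
      prefix   : ∀ s t → Pos (s ++ t) → Pos s
      legal    : ∀ s → Pos s → IsLegal s
      ≃-dom    : ∀ s t → s ≃ t → Pos s × Pos t
      ≃-refl   : ∀ s → Pos s → s ≃ s
      ≃-sym    : ∀ s t → s ≃ t → t ≃ s
      ≃-trans  : ∀ s t u → s ≃ t → t ≃ u → s ≃ u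
      I1       : ∀ s t → s ≃ t → length s ≡ length t
      I2       : ∀ s t m n i j → (s ∷ʳ (m , i)) ≃ (t ∷ʳ (n , j)) →
                 s ≃ t × player m ≡ player n × kind m ≡ kind n × i ≡ j
      I3       : ∀ s t x → s ≃ t → Pos (s ∷ʳ x) → Σ Occ λ y → Pos (t ∷ʳ y) × (s ∷ʳ x) ≃ (t ∷ʳ y)
      init-OQ  : ∀ m → InitIn Pos m → player m ≡ O × kind m ≡ Q
      ans-Q    : ∀ m n → EnablesIn Pos m n → kind n ≡ A → kind m ≡ Q
      flip     : ∀ m n → EnablesIn Pos m n → player m ≢ player n
      wf       : WFArena Pos

  renameE : (List Bool → ℕ → ℕ) → List (ℕ × List Bool) → List (ℕ × List Bool)
  renameE φ = map (λ ij → (φ (proj₂ ij) (proj₁ ij) , proj₂ ij))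

  OccRel : (List Bool → ℕ → ℕ) → Occ → Occ → Set
  OccRel φ (((b , d , e) , x , y) , p) (((b' , d' , e') , x' , y') , p') =
    p ≡ p' × x ≡ x' × y ≡ y' × b ≡ b' × d ≡ d' × e' ≡ renameE φ e

  _≃U_ : JSeq → JSeq → Set
  s ≃U t = Σ (List Bool → ℕ ↔ ℕ) λ φ →
    Pointwise (OccRel (λ w → Inverse.to (φ w))) s t

  record IsStdGame {ℓ ℓ'} (Pos : Pred JSeq ℓ) (_≃_ : JSeq → JSeq → Set ℓ') : Set (ℓ ⊔ ℓ') where
    field
      game   : IsGame Pos _≃_
      ≃⇒     : ∀ s t → s ≃ t → (s ≃U t) × Pos s × Pos t
      ⇒≃     : ∀ s t → (s ≃U t) × Pos s × Pos t → s ≃ t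
      closed : ∀ s t → IsJSeq s → Pos t → s ≃U t → Pos s

  record IsTSkel {ℓ} (S : Pred JSeq ℓ) : Set ℓ where
    field
      nonempty : Σ JSeq S
      prefix   : ∀ s t → S (s ++ t) → S s
      legal    : ∀ s → S s → IsLegal s
      det      : ∀ s m n n' → IsEven (length (s ∷ʳ m ∷ʳ n)) →
                 S (s ∷ʳ m ∷ʳ n) → S (s ∷ʳ m ∷ʳ n') → s ∷ʳ m ∷ʳ n ≡ s ∷ʳ m ∷ʳ n'
      wf       : WFArena S

  record IsStdTSkel {ℓ} (S : Pred JSeq ℓ) : Set ℓ where
    field
      tskel : IsTSkel S
      std   : ∀ s x x' → S (s ∷ʳ x) → IsJSeq (s ∷ʳ x') → IsOdd (length (s ∷ʳ x')) →
              (s ∷ʳ x) ≃U (s ∷ʳ x') → S (s ∷ʳ x')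

  ⋃ : ∀ {ℓ ℓ'} → Pred (Pred JSeq ℓ) ℓ' → Pred JSeq (lsuc ℓ ⊔ ℓ')
  ⋃ {ℓ} 𝒮 s = Σ (Pred JSeq ℓ) λ σ → 𝒮 σ × σ s

  record Consistent {ℓ ℓ'} (𝒮 : Pred (Pred JSeq ℓ) ℓ') : Set (lsuc ℓ ⊔ ℓ') where
    field
      members  : ∀ σ → 𝒮 σ → IsTSkel σ
      nonempty : Σ (Pred JSeq ℓ) 𝒮
      wf       : NoInfChain (λ m → Σ (Pred JSeq ℓ) λ σ → 𝒮 σ × InitIn σ m)
                            (λ m n → Σ (Pred JSeq ℓ) λ σ → 𝒮 σ × EnablesIn σ m n)
      coh      : ∀ σ τ → 𝒮 σ → 𝒮 τ → ∀ s x → IsOdd (length (s ∷ʳ x)) →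
                 (σ (s ∷ʳ x) ⊎ τ (s ∷ʳ x)) → σ s → τ s → σ (s ∷ʳ x) × τ (s ∷ʳ x)

  _≍_ : ∀ {ℓ} → Pred JSeq ℓ → Pred JSeq ℓ → Set (lsuc ℓ)
  σ ≍ τ = Consistent (λ ρ → (ρ ≡ σ) ⊎ (ρ ≡ τ))

  Deterministic : ∀ {ℓ ℓ'} → Pred (Pred JSeq ℓ) ℓ' → Set (lsuc ℓ ⊔ ℓ')
  Deterministic 𝒮 = ∀ s m n n' → IsEven (length (s ∷ʳ m ∷ʳ n)) →
    ⋃ 𝒮 (s ∷ʳ m ∷ʳ n) → ⋃ 𝒮 (s ∷ʳ m ∷ʳ n') → s ∷ʳ m ∷ʳ n ≡ s ∷ʳ m ∷ʳ n'

  Lesssim : (JSeq → JSeq → Set) → Pred JSeq 0ℓ → Pred JSeq 0ℓ → Set₁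
  Lesssim R σ τ = (σ ≍ τ) ×
    (∀ s m n → IsEven (length (s ∷ʳ m ∷ʳ n)) → σ (s ∷ʳ m ∷ʳ n) →
     ∀ t m' → τ (t ∷ʳ m') → R (s ∷ʳ m) (t ∷ʳ m') →
     Σ Occ λ n' → τ (t ∷ʳ m' ∷ʳ n') × R (s ∷ʳ m ∷ʳ n) (t ∷ʳ m' ∷ʳ n'))

  record PGame : Set₁ where
    field
      TS   : Pred JSeq 0ℓ → Set
      _≃G_ : JSeq → JSeq → Set

    PG : Pred JSeq (lsuc 0ℓ)
    PG = ⋃ TS

    field
      ts-nonempty : Σ (Pred JSeq 0ℓ) TS
      ts-std      : ∀ σ → TS σ → IsStdTSkel σ
      std-game    : IsStdGame PG _≃G_
      det-j       : ∀ (𝒮 : Pred (Pred JSeq 0ℓ) 0ℓ) → (∀ σ → 𝒮 σ → TS σ) →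
                    Consistent 𝒮 → Deterministic 𝒮 →
                    Σ (Pred JSeq 0ℓ) λ τ → TS τ × (∀ s → (τ s → ⋃ 𝒮 s) × (⋃ 𝒮 s → τ s))
      downward    : ∀ σ σ~ → TS σ → IsStdTSkel σ~ → σ~ ⊆ PG →
                    σ~ ≍ σ → σ~ ⊆ σ → TS σ~
      horizontal  : ∀ σ σ~ → TS σ → IsStdTSkel σ~ → σ~ ⊆ PG →
                    Lesssim _≃G_ σ σ~ → Lesssim _≃G_ σ~ σ → TS σ~

  module _ (G : PGame) where
    open PGame G

    Oinc : Pred JSeq 0ℓ → Pred JSeq 0ℓ → Set
    Oinc S T = (S ⊆ T) ×
      (∀ s x → S s → T (s ∷ʳ x) → IsOdd (length (s ∷ʳ x)) → S (s ∷ʳ x))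

    Implements : Pred JSeq 0ℓ → Pred JSeq 0ℓ → Set
    Implements σ g = Oinc σ g ×
      (∀ s m n → IsEven (length (s ∷ʳ m ∷ʳ n)) → g (s ∷ʳ m ∷ʳ n) → σ s →
       Σ Occ λ n' → σ (s ∷ʳ m ∷ʳ n') × ((s ∷ʳ m ∷ʳ n) ≃G (s ∷ʳ m ∷ʳ n')))

    record IsPStrategy (g : Pred JSeq 0ℓ) : Set₁ where
      field
        sub      : g ⊆ PG
        nonempty : Σ JSeq g
        prefix   : ∀ s t → g (s ++ t) → g s
        det≃     : ∀ s m n t l r →
                   IsEven (length (s ∷ʳ m ∷ʳ n)) → IsEven (length (t ∷ʳ l ∷ʳ r)) →
                   g (s ∷ʳ m ∷ʳ n) → g (t ∷ʳ l ∷ʳ r) → (s ∷ʳ m) ≃G (t ∷ʳ l) →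
                   (s ∷ʳ m ∷ʳ n) ≃G (t ∷ʳ l ∷ʳ r)
        closed   : ∀ s t → g s → PG t → s ≃G t → g t
        impl     : Σ (Pred JSeq 0ℓ) λ σ → TS σ × Implements σ g

    Valid : Pred JSeq 0ℓ → Set₁
    Valid σ = TS σ × Lesssim _≃G_ σ σ

-- The t-skeleton σ implementing g, which exists by definition of a p-strategy, is
-- already valid. For σ ≲ σ: a P-answer
-- smn in σ lies in g; (I3) carries it along sm ≃ tm' to some tm'y, which lies in g
-- because g is ≃-closed, and σ, implementing g, answers tm' by some tm'n' ≃ tm'y.
module Submission where

open import Defs
open import Level using (Level; 0ℓ)
open import Data.Product using (Σ; _×_; _,_)
open import Data.Sum using (_⊎_; inj₁; reduce)
open import Data.List using ([]; _∷_; _∷ʳ_; length)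
open import Relation.Unary using (Pred)
open import Relation.Binary.PropositionalEquality using (_≡_; refl; sym; subst)

≍-refl : ∀ {ℓ : Level} (𝔅 : BaseSet) {σ : Pred (JSeq 𝔅) ℓ} → IsTSkel 𝔅 σ → _≍_ 𝔅 σ σ
≍-refl {ℓ} 𝔅 {σ} σ-tskel = record
  { members  = λ _ ρ∈ → subst (IsTSkel 𝔅) (sym (reduce ρ∈)) σ-tskel
  ; nonempty = σ , inj₁ refl
  ; wf       = λ { (f , (_ , ρ∈ , init) , chain) →
                   IsTSkel.wf σ-tskel
                     ( f
                     , subst (λ ρ → InitIn 𝔅 ρ (f 0)) (reduce ρ∈) init
                     , λ k → enables∈σ (chain k)) }
  ; coh      = coh
  }
  where
    enables∈σ : ∀ {m n} →
                Σ (Pred (JSeq 𝔅) ℓ) (λ ρ → ((ρ ≡ σ) ⊎ (ρ ≡ σ)) × EnablesIn 𝔅 ρ m n) →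
                EnablesIn 𝔅 σ m n
    enables∈σ (_ , ρ∈ , e) = subst (λ ρ → EnablesIn 𝔅 ρ _ _) (reduce ρ∈) e

    coh : ∀ ρ τ → (ρ ≡ σ) ⊎ (ρ ≡ σ) → (τ ≡ σ) ⊎ (τ ≡ σ) →
          ∀ s x → IsOdd (length (s ∷ʳ x)) → ρ (s ∷ʳ x) ⊎ τ (s ∷ʳ x) → ρ s → τ s →
          ρ (s ∷ʳ x) × τ (s ∷ʳ x)
    coh ρ τ ρ∈ τ∈ s x _ sx∈ _ _ with reduce ρ∈ | reduce τ∈
    ... | refl | refl = reduce sx∈ , reduce sx∈

module _ {𝔅 : BaseSet} (G : PGame 𝔅) where
  open PGame G
  open IsGame (IsStdGame.game std-game) using (I1; I3; ≃-trans)

  implements⇒lesssim-self : ∀ {g σ} → IsPStrategy 𝔅 G g → IsTSkel 𝔅 σ →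
                            Implements 𝔅 G σ g → Lesssim 𝔅 _≃G_ σ σ
  implements⇒lesssim-self {g} {σ} g-strat σ-tskel ((σ⊆g , _) , answers) =
    ≍-refl 𝔅 σ-tskel , respond
    where
      open IsPStrategy g-strat using (sub; closed)

      respond : ∀ s m n → IsEven (length (s ∷ʳ m ∷ʳ n)) → σ (s ∷ʳ m ∷ʳ n) →
                ∀ t m' → σ (t ∷ʳ m') → (s ∷ʳ m) ≃G (t ∷ʳ m') →
                Σ (Occ 𝔅) λ n' → σ (t ∷ʳ m' ∷ʳ n') × ((s ∷ʳ m ∷ʳ n) ≃G (t ∷ʳ m' ∷ʳ n'))
      respond s m n even σsmn t m' σtm' sm≃tm'
        with I3 _ _ n sm≃tm' (sub (σ⊆g σsmn))
      ... | y , tm'y∈G , smn≃tm'y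
        with answers t m' y (subst IsEven (I1 _ _ smn≃tm'y) even)
                       (closed _ _ (σ⊆g σsmn) tm'y∈G smn≃tm'y)
                       (IsTSkel.prefix σ-tskel t (m' ∷ []) σtm')
      ... | n' , σtm'n' , tm'y≃tm'n' = n' , σtm'n' , ≃-trans _ _ _ smn≃tm'y tm'y≃tm'n'

mainTheorem9 : (𝔅 : BaseSet) (G : PGame 𝔅) (g : Pred (JSeq 𝔅) 0ℓ) →
    IsPStrategy 𝔅 G g →
    Σ (Pred (JSeq 𝔅) 0ℓ) λ σ → Valid 𝔅 G σ × Implements 𝔅 G σ g
mainTheorem9 𝔅 G g g-strat with IsPStrategy.impl g-strat
... | σ , σ∈TS , σ∝g = σ , (σ∈TS , implements⇒lesssim-self G g-strat σ-tskel σ∝g) , σ∝g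
  where
    σ-tskel : IsTSkel 𝔅 σ
    σ-tskel = IsStdTSkel.tskel (PGame.ts-std G σ σ∈TS)
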